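{- For every integer $K$, every integer $m\ge2$ and every integer $n$ with $0\le n\le \pi_K(m)$, $F_{K,\pi_K(m)-n}\equiv (-1)^{n+1}F_{K,n}\pmod m$.
   Context: For an integer $K$, the $K$-Fibonacci sequence is $F_{K,0}=0$, $F_{K,1}=1$, $F_{K,n}=KF_{K,n-1}+F_{K,n-2}$ for $n\ge2$. For an integer $m\ge 2$, $\pi_K(m)$ is the least positive period of the sequence $(F_{K,n}\bmod m)$. -}

module Defs where

open import Data.Nat using (ℕ; zero; suc; _+_; _<_; _≤_)
open import Data.Integer as ℤ using (ℤ; +_; -_; _-_)
open import Data.Integer.Divisibility using (_∣_)
open import Data.Product using (_×_)

F : ℤ → ℕ → ℤ
F K zero = + 0
F K (suc zero) = + 1
F K (suc (suc n)) = K ℤ.* F K (suc n) ℤ.+ F K n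

_≡_[mod_] : ℤ → ℤ → ℕ → Set
a ≡ b [mod m ] = (+ m) ∣ (a - b)

IsPeriod : ℤ → ℕ → ℕ → Set
IsPeriod K m p = ∀ n → F K (p + n) ≡ F K n [mod m ]

IsPisano : ℤ → ℕ → ℕ → Set
IsPisano K m p = 0 < p × IsPeriod K m p × (∀ q → 0 < q → IsPeriod K m q → p ≤ q)

sgnPow : ℕ → ℤ
sgnPow zero = + 1
sgnPow (suc n) = - sgnPow n

-- Read backwards, the recurrence says F i = F (i+2) - K F (i+1), and the extension
-- F-neg n = (-1)^(n+1) F n of F to negative indices satisfies the same backward recurrence.
-- So the defect F (p - n) - F-neg n obeys it as well; periodicity makes it vanish modulo m
-- at n = 0 (F p ≡ F 0) and n = 1 (F (p-1) ≡ F (p+1) - K F p ≡ 1).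
{-# OPTIONS --safe #-}
module Submission where

open import Defs
open import Data.Nat using (ℕ; _≤_; _∸_; suc; _+_)
open import Data.Nat.Properties using (+-suc; +-comm; m+[n∸m]≡n)
open import Data.Integer as ℤ using (ℤ; _*_; +_; -_; _-_)
open import Data.Integer.Properties using (*-zeroʳ)
open import Data.Integer.Divisibility.Signed using (_∣_; ∣ᵤ⇒∣; ∣⇒∣ᵤ; ∣m∣n⇒∣m-n; ∣n⇒∣m*n)
open import Data.Integer.Tactic.RingSolver using (solve-∀)
open import Data.Product using (_,_)
open import Relation.Binary.PropositionalEquality using (_≡_; sym; trans; cong; subst)

F-neg : ℤ → ℕ → ℤ
F-neg K n = sgnPow (suc n) * F K n

F-neg-backward : ∀ K n → F-neg K (suc (suc n)) ≡ F-neg K n - K * F-neg K (suc n)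
F-neg-backward K n = alternate K (sgnPow (suc n)) (F K (suc n)) (F K n)
  where
  alternate : ∀ k s x y → (- - s) * (k * x ℤ.+ y) ≡ s * y - k * ((- s) * x)
  alternate = solve-∀

-- Divisibility is signed from here on: being a record, it lets Agda infer the
-- dividend, which the unsigned relation (a function of ∣ a - b ∣) does not.
module _ (K : ℤ) (m : ℕ) where

  F-backward-defect : ∀ i a b →
    (F K (suc (suc i)) - a) - K * (F K (suc i) - b) ≡ F K i - (a - K * b)
  F-backward-defect i a b = regroup K (F K (suc i)) (F K i) a b
    where
    regroup : ∀ k x y a b → (k * x ℤ.+ y - a) - k * (x - b) ≡ y - (a - k * b)
    regroup = solve-∀

  F-backward-∣ : ∀ i a b → + m ∣ F K (suc (suc i)) - a → + m ∣ F K (suc i) - b →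
    + m ∣ F K i - (a - K * b)
  F-backward-∣ i a b m∣F₂-a m∣F₁-b =
    subst (+ m ∣_) (F-backward-defect i a b) (∣m∣n⇒∣m-n m∣F₂-a (∣n⇒∣m*n K m∣F₁-b))

  F-period-shift : ∀ p → IsPeriod K m p → ∀ j → + m ∣ F K (j + p) - F K j
  F-period-shift p period j =
    ∣ᵤ⇒∣ (subst (λ q → F K q ≡ F K j [mod m ]) (+-comm p j) (period j))

  F-period-reflection : ∀ n i → IsPeriod K m (n + i) → + m ∣ F K i - F-neg K n
  F-period-reflection 0 i period = F-period-shift i period 0
  F-period-reflection 1 i period =
    subst (λ c → + m ∣ F K i - c) (cong (λ x → + 1 - x) (*-zeroʳ K))
      (F-backward-∣ i (F K 1) (F K 0) (F-period-shift (suc i) period 1)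
                                      (F-period-shift (suc i) period 0))
  F-period-reflection (suc (suc n)) i period =
    subst (λ c → + m ∣ F K i - c) (sym (F-neg-backward K n))
      (F-backward-∣ i (F-neg K n) (F-neg K (suc n))
        (F-period-reflection n (suc (suc i)) (subst (IsPeriod K m) n+i+2 period))
        (F-period-reflection (suc n) (suc i) (subst (IsPeriod K m) n+i+1 period)))
    where
    n+i+1 : suc (suc (n + i)) ≡ suc (n + suc i)
    n+i+1 = cong suc (sym (+-suc n i))
    n+i+2 : suc (suc (n + i)) ≡ n + suc (suc i)
    n+i+2 = trans n+i+1 (sym (+-suc n (suc i)))

theorem4p13 : ∀ (K : ℤ) (m : ℕ) → 2 ≤ m → (p : ℕ) → IsPisano K m p →
    ∀ (n : ℕ) → n ≤ p → F K (p ∸ n) ≡ sgnPow (suc n) * F K n [mod m ]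
theorem4p13 K m _ p (_ , period , _) n n≤p =
  ∣⇒∣ᵤ (F-period-reflection K m n (p ∸ n) (subst (IsPeriod K m) (sym (m+[n∸m]≡n n≤p)) period))
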